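{- For any $y\in\{0,1,\dots,k_1\}$ and $i_2,\dots,i_n\in\{0,1,\dots,m\}$, if $opt(m',y,i_2,\dots,i_n)\neq\perp$, then $opt^*(m',y,i_2,\dots,i_n)$ is a greedy allocation sequence for an instance dominated by the original instance.
   Context: Sequential allocation: items $O$, $|O|=m$, agents $N=\{1,\dots,n\}$ with strict rankings $\succ_i$, policy $\pi$ of length $m$; agent 1 is the manipulator with additive utility $u$ consistent with $\succ_1$, appearing $k_1$ times in $\pi$; $m'=m-k_1$. Non-manipulators take their most preferred remaining item at their turns; the manipulator follows a picking strategy (permutation of $O$), taking the first remaining item at each of its turns. An allocation sequence is feasible if produced this way by some policy and picking strategy; its associated policy is the sequence of recipients. Core of a (partial) policy: the sequence after deleting all occurrences of agent 1. Policy $\pi$ dominates $\pi'$ if same length and core and $z_i\le z'_i$ for the manipulator position vectors. A segment of $\pi$: cutting $\pi$ after each non-manipulator position gives $m'+1$ segments; $\pi^s(x)$ is the prefix consisting of the first $x$ segments, and $k(x)$ the number of occurrences of agent 1 in $\pi^s(x)$. GreedyAlg: along the policy, non-manipulators take their favourite remaining item; at a manipulator position, if the remaining policy contains a non-manipulator, the manipulator is given the favourite remaining item of the first such non-manipulator, otherwise its own best remaining item; a (partial) allocation sequence is greedy if it coincides with GreedyAlg's output on its associated (partial) policy. $pro(x,y,i_2,\dots,i_n)$ is the set of feasible partial allocation sequences such that: the core of the associated partial policy equals the core of $\pi^s(x)$; the last allocation is to a non-manipulator; exactly $x$ items go to non-manipulators and $y$ to the manipulator; for each $j\ge 2$ the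 last item allocated to agent $j$ is the $i_j$th item of $\succ_j$ ($i_j=0$ meaning none); for each $r\le x$, at most $k(r)$ items go to the manipulator during the first $r$ segments of the associated policy; and it is greedy. $opt(x,y,i_2,\dots,i_n)$ is an element of $pro(x,y,i_2,\dots,i_n)$ giving the manipulator maximum utility, or $\perp$ if the set is empty. $opt^*(m',y,i_2,\dots,i_n)$ is $opt(m',y,i_2,\dots,i_n)$ followed by $k_1-y$ allocations of the $k_1-y$ best (under $\succ_1$) remaining items to the manipulator. The original instance is $(O,N,\pi,\{\succ_i\})$. -}

module Defs where

open import Data.Nat using (ℕ; zero; suc; _≤_; _∸_)
open import Data.Fin using (Fin; zero; suc; fromℕ<; _≟_)
open import Data.Fin.Base using () renaming (_<_ to _<ᶠ_)
open import Data.Bool using (Bool; true; false; if_then_else_)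
open import Data.List using (List; []; _∷_; map; _++_; take; length)
open import Data.List.Base using (allFin)
open import Data.List.Relation.Binary.Permutation.Propositional using (_↭_)
open import Data.List.Relation.Binary.Pointwise using (Pointwise)
open import Data.Maybe using (Maybe; just; nothing)
import Data.Maybe as Maybe
open import Data.Product using (Σ; _×_; _,_; proj₁; proj₂)
open import Data.Unit using (⊤)
open import Data.Rational using (ℚ; 0ℚ; _+_) renaming (_≤_ to _≤ℚ_)
open import Relation.Nullary using (¬_)
open import Relation.Nullary.Decidable using (⌊_⌋)
open import Relation.Binary.PropositionalEquality using (_≡_; _≢_)

-- Conventions
--  * items   O = Fin m
--  * agents  N = Fin (suc n); agent `zero` is the manipulator (agent 1 of
--    the paper), agent `suc j` (j : Fin n) is the non-manipulator j+2.
--    (So the paper's number of agents is suc n.)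
--  * a strict ranking of agent a is given by `P a : Fin m → Fin m`,
--    `P a k` = the (k+1)-th most preferred item of agent a (required to be
--    injective, i.e. a permutation of O).
--  * a policy is a list of agents; an allocation sequence is a list of
--    (recipient , item) pairs, in order.

Agent : ℕ → Set
Agent n = Fin (suc n)

Prefs : ℕ → ℕ → Set
Prefs n m = Agent n → Fin m → Fin m

Alloc : ℕ → ℕ → Set
Alloc n m = Agent n × Fin m

policy : ∀ {n m} → List (Alloc n m) → List (Agent n)
policy = map proj₁

count1 : ∀ {n} → List (Agent n) → ℕ
count1 [] = 0
count1 (zero ∷ p) = suc (count1 p)
count1 (suc _ ∷ p) = count1 p

countN : ∀ {n} → List (Agent n) → ℕ
countN [] = 0
countN (zero ∷ p) = countN p
countN (suc _ ∷ p) = suc (countN p)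

core : ∀ {n} → List (Agent n) → List (Agent n)
core [] = []
core (zero ∷ p) = core p
core (suc j ∷ p) = suc j ∷ core p

positionsFrom : ∀ {n} → ℕ → List (Agent n) → List ℕ
positionsFrom k [] = []
positionsFrom k (zero ∷ p) = k ∷ positionsFrom (suc k) p
positionsFrom k (suc _ ∷ p) = positionsFrom (suc k) p

positions : ∀ {n} → List (Agent n) → List ℕ
positions = positionsFrom 0

Dominates : ∀ {n} → List (Agent n) → List (Agent n) → Set
Dominates p p' = (length p ≡ length p') × (core p ≡ core p')
               × Pointwise _≤_ (positions p) (positions p')

-- segPrefix x p = π^s(x): the first x segments, where p is cut after each
-- non-manipulator position (i.e. the prefix up to and including the x-th
-- non-manipulator occurrence; the whole list if there are fewer).
segPrefix : ∀ {n} → ℕ → List (Agent n) → List (Agent n)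
segPrefix zero _ = []
segPrefix (suc x) [] = []
segPrefix (suc x) (zero ∷ p) = zero ∷ segPrefix (suc x) p
segPrefix (suc x) (suc j ∷ p) = suc j ∷ segPrefix x p

elemB : ∀ {m} → Fin m → List (Fin m) → Bool
elemB o [] = false
elemB o (x ∷ xs) = if ⌊ o ≟ x ⌋ then true else elemB o xs

firstNotIn : ∀ {m} → List (Fin m) → List (Fin m) → Maybe (Fin m)
firstNotIn [] t = nothing
firstNotIn (x ∷ xs) t = if elemB x t then firstNotIn xs t else just x

notIn : ∀ {m} → List (Fin m) → List (Fin m) → List (Fin m)
notIn [] t = []
notIn (x ∷ xs) t = if elemB x t then notIn xs t else x ∷ notIn xs t

prefList : ∀ {n m} → Prefs n m → Agent n → List (Fin m)
prefList {m = m} P a = map (P a) (allFin m)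

fav : ∀ {n m} → Prefs n m → Agent n → List (Fin m) → Maybe (Fin m)
fav P a t = firstNotIn (prefList P a) t

consM : ∀ {A : Set} → A → Maybe (List A) → Maybe (List A)
consM x = Maybe.map (x ∷_)

-- the sequential allocation mechanism (t = items already allocated)

run : ∀ {n m} → Prefs n m → List (Fin m) → List (Agent n) → List (Fin m)
    → Maybe (List (Alloc n m))
run P σ [] t = just []
run P σ (zero ∷ p) t with firstNotIn σ t
... | nothing = nothing
... | just o = consM (zero , o) (run P σ p (o ∷ t))
run P σ (suc j ∷ p) t with fav P (suc j) t
... | nothing = nothing
... | just o = consM (suc j , o) (run P σ p (o ∷ t))

Feasible : ∀ {n m} → Prefs n m → List (Alloc n m) → Set
Feasible {n} {m} P s =
  Σ (List (Fin m)) λ σ → (σ ↭ allFin m) × (run P σ (policy s) [] ≡ just s)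

firstNonManip : ∀ {n} → List (Agent n) → Maybe (Fin n)
firstNonManip [] = nothing
firstNonManip (zero ∷ p) = firstNonManip p
firstNonManip (suc j ∷ p) = just j

greedyTarget : ∀ {n} → List (Agent n) → Agent n
greedyTarget p with firstNonManip p
... | just j = suc j
... | nothing = zero

greedyRun : ∀ {n m} → Prefs n m → List (Agent n) → List (Fin m)
          → Maybe (List (Alloc n m))
greedyRun P [] t = just []
greedyRun P (zero ∷ p) t with fav P (greedyTarget p) t
... | nothing = nothing
... | just o = consM (zero , o) (greedyRun P p (o ∷ t))
greedyRun P (suc j ∷ p) t with fav P (suc j) t
... | nothing = nothing
... | just o = consM (suc j , o) (greedyRun P p (o ∷ t))

Greedy : ∀ {n m} → Prefs n m → List (Alloc n m) → Set
Greedy P s = greedyRun P (policy s) [] ≡ just s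

lastItemOf : ∀ {n m} → Agent n → List (Alloc n m) → Maybe (Fin m)
lastItemOf a [] = nothing
lastItemOf a ((b , o) ∷ s) with lastItemOf a s
... | just o' = just o'
... | nothing = if ⌊ a ≟ b ⌋ then just o else nothing

-- the last item allocated to agent j+2 is the i-th item of its ranking
-- (i = 0: nothing is allocated to it)
LastIs : ∀ {n m} → Prefs n m → Fin n → List (Alloc n m) → ℕ → Set
LastIs P j s zero = lastItemOf (suc j) s ≡ nothing
LastIs {m = m} P j s (suc i) =
  Σ (suc i Data.Nat.≤ m) λ lt → lastItemOf (suc j) s ≡ just (P (suc j) (fromℕ< lt))

LastNonManip : ∀ {n m} → List (Alloc n m) → Set
LastNonManip [] = ⊤
LastNonManip (x ∷ []) = proj₁ x ≢ zero
LastNonManip (_ ∷ y ∷ ys) = LastNonManip (y ∷ ys)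

InPro : ∀ {n m} → Prefs n m → List (Agent n) → ℕ → ℕ → (Fin n → ℕ)
      → List (Alloc n m) → Set
InPro P π x y i s =
    Feasible P s
  × (core (policy s) ≡ core (segPrefix x π))
  × LastNonManip s
  × (countN (policy s) ≡ x)
  × (count1 (policy s) ≡ y)
  × (∀ j → LastIs P j s (i j))
  × (∀ r → r ≤ x → count1 (segPrefix r (policy s)) ≤ count1 (segPrefix r π))
  × Greedy P s

utility : ∀ {n m} → (Fin m → ℚ) → List (Alloc n m) → ℚ
utility u [] = 0ℚ
utility u ((zero , o) ∷ s) = u o + utility u s
utility u ((suc _ , o) ∷ s) = utility u s

-- s is (a possible value of) opt(x, y, i)
IsOpt : ∀ {n m} → Prefs n m → List (Agent n) → (Fin m → ℚ) → ℕ → ℕ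
      → (Fin n → ℕ) → List (Alloc n m) → Set
IsOpt P π u x y i s =
  InPro P π x y i s × (∀ s' → InPro P π x y i s' → utility u s' ≤ℚ utility u s)

-- opt* : s followed by the (k1 - y) best remaining items (under ≻_1),
-- allocated to the manipulator in that order
optStar : ∀ {n m} → Prefs n m → List (Agent n) → ℕ → List (Alloc n m)
        → List (Alloc n m)
optStar P π y s =
  s ++ map (zero ,_) (take (count1 π ∸ y) (notIn (prefList P zero) (map proj₂ s)))

module Submission where

-- opt* extends opt by manipulator picks only, so length and core are unchanged, and because opt
-- respects the bound k(r) on every prefix of segments, each manipulator pick of the extended policy
-- comes no later than the corresponding one in π: this is domination. Since opt ends with a
-- non-manipulator, GreedyAlg on the extended policy first reproduces opt (the greedy target at each
-- manipulator position of opt lies inside opt) and then, with no non-manipulator left, hands the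
-- manipulator its best remaining items, which is the appended tail. A counting argument with the
-- injective rankings shows that k₁ − y items do remain.

open import Defs
open import Data.Nat using (ℕ; zero; suc; _≤_; _<_; _∸_; _+_; z≤n; s≤s; _≤?_)
open import Data.Nat.Properties
  using (≤-refl; ≤-trans; ≤-reflexive; ≤-pred; n≤1+n; n≤0⇒n≡0; ≰⇒>; suc-injective; +-suc; +-assoc;
         +-identityʳ; +-monoˡ-≤; +-cancelʳ-≤; m+n∸m≡n; m+[n∸m]≡n; m∸n+n≡m; m≤n⇒m⊓n≡m)
open import Data.Fin using (Fin; zero; suc; _≟_) renaming (_<_ to _<ᶠ_)
open import Data.List using (List; []; _∷_; _++_; map; take; length)
open import Data.List.Base using (allFin)
open import Data.List.Properties using (map-++; length-map; length-take; length-tabulate; ++-identityʳ)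
open import Data.List.Relation.Unary.All using (All; []; _∷_)
open import Data.List.Relation.Unary.AllPairs using ([]; _∷_)
open import Data.List.Relation.Unary.Unique.Propositional using (Unique)
open import Data.List.Relation.Unary.Unique.Propositional.Properties using (map⁺; allFin⁺)
open import Data.List.Relation.Binary.Pointwise as Pointwise using (Pointwise; []; _∷_)
open import Data.Bool using (true; false; _∨_)
open import Data.Bool.Properties using (∨-zeroʳ; ∨-identityʳ)
open import Data.Maybe using (Maybe; just; nothing; _>>=_)
open import Data.Maybe.Properties using () renaming (map-id to maybe-map-id)
import Data.Maybe as Maybe
open import Data.Product using (Σ; _×_; _,_; proj₁; proj₂)
open import Data.Unit using (⊤; tt)
open import Data.Empty using (⊥-elim)
open import Data.Rational using (ℚ) renaming (_<_ to _<ℚ_)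
open import Function using (_∘_)
open import Function.Definitions using (Injective)
open import Relation.Nullary using (yes; no)
open import Relation.Binary.PropositionalEquality

count1-++ : ∀ {n} (p q : List (Agent n)) → count1 (p ++ q) ≡ count1 p + count1 q
count1-++ []          q = refl
count1-++ (zero  ∷ p) q = cong suc (count1-++ p q)
count1-++ (suc _ ∷ p) q = count1-++ p q

countN-++ : ∀ {n} (p q : List (Agent n)) → countN (p ++ q) ≡ countN p + countN q
countN-++ []          q = refl
countN-++ (zero  ∷ p) q = countN-++ p q
countN-++ (suc _ ∷ p) q = cong suc (countN-++ p q)

count1+countN≡length : ∀ {n} (p : List (Agent n)) → count1 p + countN p ≡ length p
count1+countN≡length []          = refl
count1+countN≡length (zero  ∷ p) = cong suc (count1+countN≡length p)
count1+countN≡length (suc _ ∷ p) = trans (+-suc _ _) (cong suc (count1+countN≡length p))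

core-++ : ∀ {n} (p q : List (Agent n)) → core (p ++ q) ≡ core p ++ core q
core-++ []          q = refl
core-++ (zero  ∷ p) q = core-++ p q
core-++ (suc j ∷ p) q = cong (suc j ∷_) (core-++ p q)

countN≡0⇒core≡[] : ∀ {n} (p : List (Agent n)) → countN p ≡ 0 → core p ≡ []
countN≡0⇒core≡[] []          _ = refl
countN≡0⇒core≡[] (zero  ∷ p) e = countN≡0⇒core≡[] p e

count1≡0⇒positionsFrom≡[] : ∀ {n} (p : List (Agent n)) k → count1 p ≡ 0 → positionsFrom k p ≡ []
count1≡0⇒positionsFrom≡[] []          k _ = refl
count1≡0⇒positionsFrom≡[] (suc _ ∷ p) k e = count1≡0⇒positionsFrom≡[] p (suc k) e

count1-map-suc-++ : ∀ {n} (js : List (Fin n)) (p : List (Agent n)) → count1 (map suc js ++ p) ≡ count1 p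
count1-map-suc-++ []       p = refl
count1-map-suc-++ (_ ∷ js) p = count1-map-suc-++ js p

EndsWithNonManip : ∀ {n} → List (Agent n) → Set
EndsWithNonManip []          = ⊤
EndsWithNonManip (a ∷ [])    = a ≢ zero
EndsWithNonManip (_ ∷ b ∷ p) = EndsWithNonManip (b ∷ p)

EndsWithNonManip-tail : ∀ {n} (a : Agent n) p → EndsWithNonManip (a ∷ p) → EndsWithNonManip p
EndsWithNonManip-tail a []      _ = tt
EndsWithNonManip-tail a (_ ∷ _) e = e

lastNonManip⇒endsWithNonManip : ∀ {n m} (s : List (Alloc n m)) → LastNonManip s → EndsWithNonManip (policy s)
lastNonManip⇒endsWithNonManip []          _ = tt
lastNonManip⇒endsWithNonManip (_ ∷ [])    h = h
lastNonManip⇒endsWithNonManip (_ ∷ b ∷ s) h = lastNonManip⇒endsWithNonManip (b ∷ s) h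

segPrefix-++ : ∀ {n} (p q : List (Agent n)) r → EndsWithNonManip p → r ≤ countN p
             → segPrefix r (p ++ q) ≡ segPrefix r p
segPrefix-++ p               q zero          _ _       = refl
segPrefix-++ (zero ∷ [])     q (suc r)       e _       = ⊥-elim (e refl)
segPrefix-++ (zero ∷ b ∷ p)  q (suc r)       e h       = cong (zero ∷_) (segPrefix-++ (b ∷ p) q (suc r) e h)
segPrefix-++ (suc j ∷ [])    q (suc zero)    _ _       = refl
segPrefix-++ (suc j ∷ [])    q (suc (suc r)) _ (s≤s ())
segPrefix-++ (suc j ∷ b ∷ p) q (suc r)       e (s≤s h) = cong (suc j ∷_) (segPrefix-++ (b ∷ p) q r e h)

segPrefix-all : ∀ {n} (p : List (Agent n)) r → countN p < r → segPrefix r p ≡ p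
segPrefix-all []          (suc r) _       = refl
segPrefix-all (zero  ∷ p) (suc r) h       = cong (zero ∷_) (segPrefix-all p (suc r) h)
segPrefix-all (suc j ∷ p) (suc r) (s≤s h) = cong (suc j ∷_) (segPrefix-all p r h)

core-segPrefix : ∀ {n} (p : List (Agent n)) r → countN p ≤ r → core (segPrefix r p) ≡ core p
core-segPrefix []          zero    _       = refl
core-segPrefix []          (suc r) _       = refl
core-segPrefix (zero  ∷ p) zero    h       = sym (countN≡0⇒core≡[] p (n≤0⇒n≡0 h))
core-segPrefix (zero  ∷ p) (suc r) h       = core-segPrefix p (suc r) h
core-segPrefix (suc j ∷ p) (suc r) (s≤s h) = cong (suc j ∷_) (core-segPrefix p r h)

_≤*_ : List ℕ → List ℕ → Set
_≤*_ = Pointwise _≤_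

≤*-refl : ∀ {xs} → xs ≤* xs
≤*-refl = Pointwise.refl ≤-refl

≤*-trans : ∀ {xs ys zs} → xs ≤* ys → ys ≤* zs → xs ≤* zs
≤*-trans = Pointwise.transitive ≤-trans

_AheadOf_ : ∀ {n} → List (Agent n) → List (Agent n) → Set
p AheadOf q = ∀ r → count1 (segPrefix r q) ≤ count1 (segPrefix r p)

positionsFrom-pullManip : ∀ {n} (js : List (Fin n)) p k
  → positionsFrom k (zero ∷ map suc js ++ p) ≤* positionsFrom k (map suc js ++ zero ∷ p)
positionsFrom-pullManip []       p k = ≤*-refl
positionsFrom-pullManip (_ ∷ js) p k =
  ≤*-trans (n≤1+n k ∷ ≤*-refl) (positionsFrom-pullManip js p (suc k))

splitAtManip : ∀ {n} (q : List (Agent n)) c → count1 q ≡ suc c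
  → Σ (List (Fin n)) λ js → Σ (List (Agent n)) λ p → q ≡ map suc js ++ zero ∷ p
splitAtManip (zero  ∷ q) c e = [] , q , refl
splitAtManip (suc j ∷ q) c e with splitAtManip q c e
... | js , p , refl = j ∷ js , p , refl

AheadOf-dropManip : ∀ {n} (p : List (Agent n)) js q → (zero ∷ p) AheadOf (map suc js ++ zero ∷ q)
  → p AheadOf (map suc js ++ q)
AheadOf-dropManip p js q a zero    = z≤n
AheadOf-dropManip p js q a (suc r) = go js (suc r) (a (suc r))
  where
    go : ∀ js r {c} → count1 (segPrefix r (map suc js ++ zero ∷ q)) ≤ suc c
       → count1 (segPrefix r (map suc js ++ q)) ≤ c
    go js       zero    _ = z≤n
    go []       (suc r) h = ≤-pred h
    go (_ ∷ js) (suc r) h = go js r h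

-- When p starts with a manipulator pick, the first manipulator pick of q is moved to the front,
-- which can only lower the positions.
AheadOf⇒positionsFrom≤* : ∀ {n} (p q : List (Agent n)) → count1 p ≡ count1 q → p AheadOf q
  → ∀ k → positionsFrom k p ≤* positionsFrom k q
AheadOf⇒positionsFrom≤* [] q e a k rewrite count1≡0⇒positionsFrom≡[] q k (sym e) = []
AheadOf⇒positionsFrom≤* (zero ∷ p) q e a k with splitAtManip q (count1 p) (sym e)
... | js , q′ , refl =
  ≤*-trans (≤-refl ∷ AheadOf⇒positionsFrom≤* p (map suc js ++ q′) e′ (AheadOf-dropManip p js q′ a) (suc k))
           (positionsFrom-pullManip js q′ k)
  where
    e′ : count1 p ≡ count1 (map suc js ++ q′)
    e′ = trans (suc-injective (trans e (count1-map-suc-++ js (zero ∷ q′)))) (sym (count1-map-suc-++ js q′))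
AheadOf⇒positionsFrom≤* (suc j ∷ p) [] e a k rewrite count1≡0⇒positionsFrom≡[] p (suc k) e = []
AheadOf⇒positionsFrom≤* (suc j ∷ p) (zero ∷ q) e a k with a 1
... | ()
AheadOf⇒positionsFrom≤* (suc j ∷ p) (suc _ ∷ q) e a k =
  AheadOf⇒positionsFrom≤* p q e (λ r → a (suc r)) (suc k)

Dominates-++ : ∀ {n} (π p q : List (Agent n))
  → EndsWithNonManip p → core p ≡ core π → countN p ≡ countN π
  → (∀ r → r ≤ countN π → count1 (segPrefix r p) ≤ count1 (segPrefix r π))
  → countN q ≡ 0 → count1 p + count1 q ≡ count1 π
  → Dominates π (p ++ q)
Dominates-++ π p q ends coreEq countNEq ahead countNq≡0 count1Eq =
  sym length≡ , sym core≡ , AheadOf⇒positionsFrom≤* π (p ++ q) (sym count1≡) ahead′ 0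
  where
    count1≡ : count1 (p ++ q) ≡ count1 π
    count1≡ = trans (count1-++ p q) count1Eq

    countN≡ : countN (p ++ q) ≡ countN π
    countN≡ = trans (countN-++ p q) (trans (cong (countN p +_) countNq≡0) (trans (+-identityʳ _) countNEq))

    length≡ : length (p ++ q) ≡ length π
    length≡ = begin
      length (p ++ q)                         ≡⟨ count1+countN≡length (p ++ q) ⟨
      count1 (p ++ q) + countN (p ++ q)       ≡⟨ cong₂ _+_ count1≡ countN≡ ⟩
      count1 π + countN π                     ≡⟨ count1+countN≡length π ⟩
      length π                                ∎
      where open ≡-Reasoning

    core≡ : core (p ++ q) ≡ core π
    core≡ = begin
      core (p ++ q)      ≡⟨ core-++ p q ⟩
      core p ++ core q   ≡⟨ cong (core p ++_) (countN≡0⇒core≡[] q countNq≡0) ⟩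
      core p ++ []       ≡⟨ ++-identityʳ (core p) ⟩
      core p             ≡⟨ coreEq ⟩
      core π             ∎
      where open ≡-Reasoning

    ahead′ : π AheadOf (p ++ q)
    ahead′ r with r ≤? countN π
    ... | yes r≤ = ≤-trans (≤-reflexive (cong count1 (segPrefix-++ p q r ends (≤-trans r≤ (≤-reflexive (sym countNEq))))))
                           (ahead r r≤)
    ... | no r≰ = ≤-reflexive (begin
      count1 (segPrefix r (p ++ q)) ≡⟨ cong count1 (segPrefix-all (p ++ q) r (≤-trans (s≤s (≤-reflexive countN≡)) (≰⇒> r≰))) ⟩
      count1 (p ++ q)               ≡⟨ count1≡ ⟩
      count1 π                      ≡⟨ cong count1 (segPrefix-all π r (≰⇒> r≰)) ⟨
      count1 (segPrefix r π)        ∎)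
      where open ≡-Reasoning

notIn-fresh : ∀ {m} (L t : List (Fin m)) o → All (o ≢_) L → notIn L (o ∷ t) ≡ notIn L t
notIn-fresh []      t o _          = refl
notIn-fresh (x ∷ L) t o (o≢x ∷ os) with x ≟ o
... | yes x≡o = ⊥-elim (o≢x (sym x≡o))
... | no _ rewrite notIn-fresh L t o os = refl

notIn-cong : ∀ {m} (L : List (Fin m)) {t t′} → (∀ x → elemB x t ≡ elemB x t′) → notIn L t ≡ notIn L t′
notIn-cong []      h = refl
notIn-cong (x ∷ L) {t} {t′} h rewrite h x with elemB x t′
... | true  = notIn-cong L h
... | false = cong (x ∷_) (notIn-cong L h)

notIn≡∷⇒firstNotIn : ∀ {m} (L t : List (Fin m)) {o rest} → notIn L t ≡ o ∷ rest → firstNotIn L t ≡ just o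
notIn≡∷⇒firstNotIn (x ∷ L) t e with elemB x t
... | true  = notIn≡∷⇒firstNotIn L t e
... | false with refl ← e = refl

notIn≡∷⇒notIn-∷ : ∀ {m} (L t : List (Fin m)) {o rest} → Unique L → notIn L t ≡ o ∷ rest → notIn L (o ∷ t) ≡ rest
notIn≡∷⇒notIn-∷ (x ∷ L) t {o} (_ ∷ u) e with elemB x t
... | true with x ≟ o
...   | yes _ = notIn≡∷⇒notIn-∷ L t u e
...   | no  _ = notIn≡∷⇒notIn-∷ L t u e
notIn≡∷⇒notIn-∷ (x ∷ L) t (x∉L ∷ u) refl | false with x ≟ x
...   | yes _ = notIn-fresh L t x x∉L
...   | no x≢x = ⊥-elim (x≢x refl)

notIn-[] : ∀ {m} (L : List (Fin m)) → notIn L [] ≡ L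
notIn-[] []      = refl
notIn-[] (x ∷ L) = cong (x ∷_) (notIn-[] L)

length-notIn-∷ : ∀ {m} (L t : List (Fin m)) o → Unique L → length (notIn L t) ≤ suc (length (notIn L (o ∷ t)))
length-notIn-∷ []      t o _          = z≤n
length-notIn-∷ (x ∷ L) t o (x∉L ∷ u) with x ≟ o | elemB x t
... | yes refl | true  = length-notIn-∷ L t o u
... | yes refl | false = ≤-reflexive (cong (suc ∘ length) (sym (notIn-fresh L t x x∉L)))
... | no _     | true  = length-notIn-∷ L t o u
... | no _     | false = s≤s (length-notIn-∷ L t o u)

length-notIn : ∀ {m} (L t : List (Fin m)) → Unique L → length L ≤ length (notIn L t) + length t
length-notIn L []      u = ≤-reflexive (sym (trans (+-identityʳ _) (cong length (notIn-[] L))))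
length-notIn L (o ∷ t) u = ≤-trans (length-notIn L t u)
  (≤-trans (+-monoˡ-≤ (length t) (length-notIn-∷ L t o u)) (≤-reflexive (sym (+-suc _ _))))

length-take-notIn : ∀ {m} (L t : List (Fin m)) k → Unique L → k + length t ≤ length L
  → length (take k (notIn L t)) ≡ k
length-take-notIn L t k u h = trans (length-take k (notIn L t))
  (m≤n⇒m⊓n≡m (+-cancelʳ-≤ (length t) k _ (≤-trans h (length-notIn L t u))))

allocate : ∀ {n m} → List (Alloc n m) → List (Fin m) → List (Fin m)
allocate []            t = t
allocate ((_ , o) ∷ s) t = allocate s (o ∷ t)

elemB-allocate : ∀ {n m} (x : Fin m) (s : List (Alloc n m)) t
  → elemB x (allocate s t) ≡ elemB x (map proj₂ s) ∨ elemB x t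
elemB-allocate x []            t = refl
elemB-allocate x ((_ , o) ∷ s) t rewrite elemB-allocate x s (o ∷ t) with x ≟ o
... | yes _ = ∨-zeroʳ _
... | no  _ = refl

notIn-allocate : ∀ {n m} (L : List (Fin m)) (s : List (Alloc n m)) → notIn L (map proj₂ s) ≡ notIn L (allocate s [])
notIn-allocate L s = notIn-cong L (λ x → sym (trans (elemB-allocate x s []) (∨-identityʳ _)))

greedyTarget-++ : ∀ {n} (p q : List (Agent n)) → EndsWithNonManip (zero ∷ p) → greedyTarget (p ++ q) ≡ greedyTarget p
greedyTarget-++ []          q e = ⊥-elim (e refl)
greedyTarget-++ (suc j ∷ p) q _ = refl
greedyTarget-++ (zero ∷ p)  q e = greedyTarget-++ p q e

consM->>=-++ : ∀ {A : Set} (a : A) (X : Maybe (List A)) (Y : List A → Maybe (List A))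
  → consM a (X >>= λ s → Maybe.map (s ++_) (Y (a ∷ s))) ≡ (consM a X >>= λ s → Maybe.map (s ++_) (Y s))
consM->>=-++ a nothing  Y = refl
consM->>=-++ a (just s) Y with Y (a ∷ s)
... | nothing = refl
... | just _  = refl

toManip : ∀ {n m} → List (Fin m) → List (Alloc n m)
toManip = map (zero ,_)

count1-toManip : ∀ {n m} (xs : List (Fin m)) → count1 (policy (toManip {n} xs)) ≡ length xs
count1-toManip []       = refl
count1-toManip (_ ∷ xs) = cong suc (count1-toManip xs)

countN-toManip : ∀ {n m} (xs : List (Fin m)) → countN (policy (toManip {n} xs)) ≡ 0
countN-toManip []       = refl
countN-toManip (_ ∷ xs) = countN-toManip xs

greedyTarget-toManip : ∀ {n m} (xs : List (Fin m)) → greedyTarget (policy (toManip {n} xs)) ≡ zero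
greedyTarget-toManip []       = refl
greedyTarget-toManip (_ ∷ xs) = greedyTarget-toManip xs

module _ {n m} (P : Prefs n m) where

  -- At a manipulator position of p the greedy target is the next non-manipulator, which lies inside p.
  greedyRun-++ : ∀ p q t → EndsWithNonManip p
    → greedyRun P (p ++ q) t ≡ (greedyRun P p t >>= λ s → Maybe.map (s ++_) (greedyRun P q (allocate s t)))
  greedyRun-++ []          q t _ = sym (maybe-map-id (greedyRun P q t))
  greedyRun-++ (zero ∷ p)  q t e rewrite greedyTarget-++ p q e with fav P (greedyTarget p) t
  ... | nothing = refl
  ... | just o  = trans (cong (consM (zero , o)) (greedyRun-++ p q (o ∷ t) (EndsWithNonManip-tail zero p e)))
                        (consM->>=-++ (zero , o) (greedyRun P p (o ∷ t)) (λ s → greedyRun P q (allocate s t)))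
  greedyRun-++ (suc j ∷ p) q t e with fav P (suc j) t
  ... | nothing = refl
  ... | just o  = trans (cong (consM (suc j , o)) (greedyRun-++ p q (o ∷ t) (EndsWithNonManip-tail (suc j) p e)))
                        (consM->>=-++ (suc j , o) (greedyRun P p (o ∷ t)) (λ s → greedyRun P q (allocate s t)))

  greedyRun-toManip : Unique (prefList P zero) → ∀ k t
    → greedyRun P (policy (toManip (take k (notIn (prefList P zero) t)))) t
      ≡ just (toManip (take k (notIn (prefList P zero) t)))
  greedyRun-toManip u zero    t = refl
  greedyRun-toManip u (suc k) t with notIn (prefList P zero) t in e
  ... | []       = refl
  ... | o ∷ rest
    rewrite greedyTarget-toManip {n} (take k rest)
          | notIn≡∷⇒firstNotIn (prefList P zero) t e
          | sym (notIn≡∷⇒notIn-∷ (prefList P zero) t u e)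
          | greedyRun-toManip u k (o ∷ t)
    = refl

  Greedy-++-toManip : Unique (prefList P zero) → ∀ s k → LastNonManip s → Greedy P s
    → Greedy P (s ++ toManip (take k (notIn (prefList P zero) (map proj₂ s))))
  Greedy-++-toManip u s k last greedy rewrite notIn-allocate (prefList P zero) s = begin
    greedyRun P (policy (s ++ T)) []
      ≡⟨ cong (λ p → greedyRun P p []) (map-++ proj₁ s T) ⟩
    greedyRun P (policy s ++ policy T) []
      ≡⟨ greedyRun-++ (policy s) (policy T) [] (lastNonManip⇒endsWithNonManip s last) ⟩
    (greedyRun P (policy s) [] >>= λ s′ → Maybe.map (s′ ++_) (greedyRun P (policy T) (allocate s′ [])))
      ≡⟨ cong (_>>= λ s′ → Maybe.map (s′ ++_) (greedyRun P (policy T) (allocate s′ []))) greedy ⟩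
    Maybe.map (s ++_) (greedyRun P (policy T) (allocate s []))
      ≡⟨ cong (Maybe.map (s ++_)) (greedyRun-toManip u k (allocate s [])) ⟩
    just (s ++ T)
      ∎
    where
      open ≡-Reasoning
      T : List (Alloc n m)
      T = toManip (take k (notIn (prefList P zero) (allocate s [])))

length-prefList : ∀ {n m} (P : Prefs n m) a → length (prefList P a) ≡ m
length-prefList {m = m} P a = trans (length-map (P a) (allFin m)) (length-tabulate _)

Unique-prefList : ∀ {n m} (P : Prefs n m) a → Injective _≡_ _≡_ (P a) → Unique (prefList P a)
Unique-prefList {m = m} P a inj = map⁺ inj (allFin⁺ m)

length≡⇒∸count1≡countN : ∀ {n m} (π : List (Agent n)) → length π ≡ m → m ∸ count1 π ≡ countN π
length≡⇒∸count1≡countN π refl = trans (cong (_∸ count1 π) (sym (count1+countN≡length π))) (m+n∸m≡n (count1 π) _)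

length-remainingPicks : ∀ {n m} (π : List (Agent n)) (L : List (Fin m)) (s : List (Alloc n m)) y
  → Unique L → length L ≡ length π → count1 (policy s) ≡ y → countN (policy s) ≡ countN π → y ≤ count1 π
  → length (take (count1 π ∸ y) (notIn L (map proj₂ s))) ≡ count1 π ∸ y
length-remainingPicks π L s y unique lenL count1s countNs y≤ =
  length-take-notIn L (map proj₂ s) (count1 π ∸ y) unique (≤-reflexive (begin
    (count1 π ∸ y) + length (map proj₂ s)      ≡⟨ cong ((count1 π ∸ y) +_) (trans (length-map proj₂ s) (sym (length-map proj₁ s))) ⟩
    (count1 π ∸ y) + length (policy s)         ≡⟨ cong ((count1 π ∸ y) +_) (count1+countN≡length (policy s)) ⟨
    (count1 π ∸ y) + (count1 (policy s) + countN (policy s))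
                                               ≡⟨ cong₂ (λ a b → (count1 π ∸ y) + (a + b)) count1s countNs ⟩
    (count1 π ∸ y) + (y + countN π)            ≡⟨ +-assoc (count1 π ∸ y) y _ ⟨
    (count1 π ∸ y + y) + countN π              ≡⟨ cong (_+ countN π) (m∸n+n≡m y≤) ⟩
    count1 π + countN π                        ≡⟨ count1+countN≡length π ⟩
    length π                                   ≡⟨ lenL ⟨
    length L                                   ∎))
  where open ≡-Reasoning

lemma8 : ∀ {n m} (π : List (Agent n)) (P : Prefs n m) (u : Fin m → ℚ)
    → length π ≡ m
    → (∀ a → Injective _≡_ _≡_ (P a))
    → (∀ a b → a <ᶠ b → u (P zero b) <ℚ u (P zero a))
    → ∀ (y : ℕ) → y ≤ count1 π
    → ∀ (i : Fin n → ℕ) → (∀ j → i j ≤ m)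
    → ∀ (s : List (Alloc n m)) → IsOpt P π u (m ∸ count1 π) y i s
    → Σ (List (Agent n)) λ π′ →
        Dominates π π′ × (policy (optStar P π y s) ≡ π′) × Greedy P (optStar P π y s)
lemma8 {n} {m} π P _ lenπ inj _ y y≤ _ _ s ((_ , coreEq , last , countNs , count1s , _ , ahead , greedy) , _)
  rewrite length≡⇒∸count1≡countN π lenπ =
  policy (optStar P π y s) , dominates , refl , Greedy-++-toManip P unique s (count1 π ∸ y) last greedy
  where
    unique : Unique (prefList P zero)
    unique = Unique-prefList P zero (inj zero)

    picks : List (Fin m)
    picks = take (count1 π ∸ y) (notIn (prefList P zero) (map proj₂ s))

    tail : List (Alloc n m)
    tail = toManip picks

    length-picks : length picks ≡ count1 π ∸ y
    length-picks = length-remainingPicks π (prefList P zero) s y unique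
                     (trans (length-prefList P zero) (sym lenπ)) count1s countNs y≤

    dominates : Dominates π (policy (s ++ tail))
    dominates = subst (Dominates π) (sym (map-++ proj₁ s tail))
      (Dominates-++ π (policy s) (policy tail) (lastNonManip⇒endsWithNonManip s last)
        (trans coreEq (core-segPrefix π (countN π) ≤-refl)) countNs ahead (countN-toManip picks)
        (trans (cong₂ _+_ count1s (trans (count1-toManip picks) length-picks)) (m+[n∸m]≡n y≤)))
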